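{- Let $D$ be a finite digraph with odd period $h$, and let $S_0,\dots,S_{h-1}$ be a partition of $V(D)$ into independent sets such that every arc of $D$ goes from some $S_i$ to $S_{i+1}$ (indices modulo $h$). Then an independent dominating set $I$ of $D$ is determined entirely by $S_i\cap I$ for any fixed $i\in\{0,\dots,h-1\}$: if $I$ and $I'$ are independent dominating sets of $D$ with $S_i\cap I=S_i\cap I'$ for some $i$, then $I=I'$.
   Context: The period of a digraph is the greatest common divisor of the lengths of all directed cycles it contains. In a digraph $D=(V,A)$, $S\subseteq V$ is independent if no arc has both ends in $S$, dominating if every vertex of $V\setminus S$ has an in-neighbour in $S$, and an independent dominating set if both. -}

module Defs where

open import Data.Nat using (ℕ; zero; suc; _+_; _*_)
open import Data.Nat.Divisibility using (_∣_)
open import Data.Fin using (Fin; zero; suc; toℕ; inject₁; fromℕ)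
open import Data.Fin.Subset using (Subset; _∈_; _∉_)
open import Data.Bool using (Bool; T)
open import Data.Product using (Σ; ∃; _×_)
open import Data.Sum using (_⊎_)
open import Relation.Nullary using (¬_)
open import Relation.Binary.PropositionalEquality using (_≡_; _≢_)
open import Function.Definitions using (Injective)

record Digraph : Set where
  field
    n   : ℕ
    arc : Fin n → Fin n → Bool

open Digraph public

V : Digraph → Set
V D = Fin (n D)

Arc : (D : Digraph) → V D → V D → Set
Arc D u v = T (arc D u v)

record Cycle (D : Digraph) (len : ℕ) : Set where
  field
    m       : ℕ
    len≡    : len ≡ suc m
    c       : Fin (suc m) → V D
    c-inj   : Injective _≡_ _≡_ c
    c-step  : (j : Fin m) → Arc D (c (inject₁ j)) (c (suc j))
    c-close : Arc D (c (fromℕ m)) (c zero)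

-- h is the period of D: the greatest common divisor of the lengths of all
-- directed cycles (gcd in the divisibility order, so h = 0 if D is acyclic).
IsPeriod : Digraph → ℕ → Set
IsPeriod D h =
  ((len : ℕ) → Cycle D len → h ∣ len) ×
  ((d : ℕ) → ((len : ℕ) → Cycle D len → d ∣ len) → d ∣ h)

Odd : ℕ → Set
Odd h = ∃ λ k → h ≡ suc (2 * k)

-- S : V → Fin h assigns each vertex its (unique) part S_i; this is a
-- partition of V into S_0,…,S_{h-1}.
-- Each part S_i is independent:
PartsIndependent : (D : Digraph) {h : ℕ} → (V D → Fin h) → Set
PartsIndependent D S = ∀ u v → Arc D u v → S u ≢ S v

ArcsCyclic : (D : Digraph) {h : ℕ} → (V D → Fin h) → Set
ArcsCyclic D {h} S = ∀ u v → Arc D u v →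
  (suc (toℕ (S u)) ≡ toℕ (S v)) ⊎ (suc (toℕ (S u)) ≡ h × toℕ (S v) ≡ 0)

Independent : (D : Digraph) → Subset (n D) → Set
Independent D I = ∀ u v → u ∈ I → v ∈ I → ¬ Arc D u v

Dominating : (D : Digraph) → Subset (n D) → Set
Dominating D I = ∀ v → v ∉ I → Σ (V D) λ u → u ∈ I × Arc D u v

IndependentDominating : (D : Digraph) → Subset (n D) → Set
IndependentDominating D I = Independent D I × Dominating D I

-- If two independent dominating sets agree on every in-neighbour of v, they
-- agree at v: a vertex of I outside I′ would be dominated by some u ∈ I′,
-- hence u ∈ I, contradicting independence of I. Every in-neighbour of a vertex
-- of S_{j+1} lies in S_j, so agreement on S_i spreads to S_{i+1}, S_{i+2}, …
-- around the cycle of parts to all of V.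
module Submission where

open import Defs
open import Data.Nat using (ℕ; zero; suc; _+_; _∸_)
open import Data.Nat.Properties using (suc-injective; m∸n+n≡m; +-suc; +-identityʳ)
open import Data.Fin using (Fin; toℕ)
open import Data.Fin.Properties using (toℕ-injective; toℕ<n)
open import Data.Fin.Subset using (Subset; _∈_)
open import Data.Fin.Subset.Properties using (_∈?_; ⊆-antisym)
open import Data.Product using (_×_; _,_; proj₁; proj₂)
open import Data.Sum using (inj₁; inj₂)
open import Data.Empty using (⊥-elim)
open import Relation.Nullary using (yes; no)
open import Relation.Binary.PropositionalEquality using (_≡_; sym; trans)

InheritedFromInNeighbours : (D : Digraph) → (V D → Set) → Set
InheritedFromInNeighbours D P = ∀ v → (∀ u → Arc D u v → P u) → P v

module _ {D : Digraph} where

  ∈-inherited : ∀ {J J′} → Independent D J → Dominating D J′ →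
                ∀ v → (∀ u → Arc D u v → u ∈ J′ → u ∈ J) → v ∈ J → v ∈ J′
  ∈-inherited {J′ = J′} independent dominating v inNeighbours v∈J with v ∈? J′
  ... | yes v∈J′ = v∈J′
  ... | no v∉J′ with dominating v v∉J′
  ...   | u , u∈J′ , uv = ⊥-elim (independent u v (inNeighbours u uv u∈J′) v∈J uv)

  agreement-inherited : ∀ {J J′} → IndependentDominating D J → IndependentDominating D J′ →
                        InheritedFromInNeighbours D (λ v → (v ∈ J → v ∈ J′) × (v ∈ J′ → v ∈ J))
  agreement-inherited (indJ , domJ) (indJ′ , domJ′) v agree =
      ∈-inherited indJ domJ′ v (λ u uv → proj₂ (agree u uv))
    , ∈-inherited indJ′ domJ v (λ u uv → proj₁ (agree u uv))

module _ (D : Digraph) {h : ℕ} (S : V D → Fin h) (cyclic : ArcsCyclic D S) where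

  inNeighbour-previousPart : ∀ {u v a} → Arc D u v → toℕ (S v) ≡ suc a → toℕ (S u) ≡ a
  inNeighbour-previousPart {u} {v} uv Sv≡1+a with cyclic u v uv
  ... | inj₁ step = suc-injective (trans step Sv≡1+a)
  ... | inj₂ (_ , Sv≡0) with trans (sym Sv≡0) Sv≡1+a
  ...   | ()

  inNeighbour-lastPart : ∀ {u v a} → Arc D u v → toℕ (S v) ≡ 0 → suc a ≡ h → toℕ (S u) ≡ a
  inNeighbour-lastPart {u} {v} uv Sv≡0 1+a≡h with cyclic u v uv
  ... | inj₁ step with trans step Sv≡0
  ...   | ()
  inNeighbour-lastPart uv Sv≡0 1+a≡h | inj₂ (wrap , _) = suc-injective (trans wrap (sym 1+a≡h))

  module _ (P : V D → Set) (inherited : InheritedFromInNeighbours D P) where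

    HoldsOnPart : ℕ → Set
    HoldsOnPart a = ∀ v → toℕ (S v) ≡ a → P v

    holdsOnPart-suc : ∀ {a} → HoldsOnPart a → HoldsOnPart (suc a)
    holdsOnPart-suc Pa v Sv≡1+a =
      inherited v λ u uv → Pa u (inNeighbour-previousPart uv Sv≡1+a)

    holdsOnPart-+ : ∀ {a} → HoldsOnPart a → ∀ k → HoldsOnPart (k + a)
    holdsOnPart-+ Pa zero    = Pa
    holdsOnPart-+ Pa (suc k) = holdsOnPart-suc (holdsOnPart-+ Pa k)

    holdsOnPart-zero : (i : Fin h) → HoldsOnPart (toℕ i) → HoldsOnPart 0
    holdsOnPart-zero i Pi v Sv≡0 = inherited v λ u uv →
      holdsOnPart-+ Pi k u (inNeighbour-lastPart uv Sv≡0 lastPart)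
      where
      k : ℕ
      k = h ∸ suc (toℕ i)
      lastPart : suc (k + toℕ i) ≡ h
      lastPart = trans (sym (+-suc k (toℕ i))) (m∸n+n≡m (toℕ<n i))

    holdsOnPart⇒holds : (i : Fin h) → HoldsOnPart (toℕ i) → ∀ v → P v
    holdsOnPart⇒holds i Pi v =
      holdsOnPart-+ (holdsOnPart-zero i Pi) (toℕ (S v)) v (sym (+-identityʳ (toℕ (S v))))

mainTheorem17 : (D : Digraph) (h : ℕ) → IsPeriod D h → Odd h →
    (S : V D → Fin h) → PartsIndependent D S → ArcsCyclic D S →
    (I I′ : Subset (n D)) → IndependentDominating D I → IndependentDominating D I′ →
    (i : Fin h) → (∀ v → S v ≡ i → (v ∈ I → v ∈ I′) × (v ∈ I′ → v ∈ I)) →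
    I ≡ I′
mainTheorem17 D h _ _ S _ cyclic I I′ idI idI′ i agreeOnSi =
  ⊆-antisym (λ {v} → proj₁ (agree v)) (λ {v} → proj₂ (agree v))
  where
  agree : ∀ v → (v ∈ I → v ∈ I′) × (v ∈ I′ → v ∈ I)
  agree = holdsOnPart⇒holds D S cyclic _ (agreement-inherited idI idI′) i
            (λ v Sv≡i → agreeOnSi v (toℕ-injective Sv≡i))
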